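{- Let $p$ be a prime, $r\in\{1,\dots,p-1\}$, $R\in\{\mathbb{F}_p,\mathbb{C}\}$, and let $V\subset\mathbb{F}_p^n$ be an $(r,R)$-irredundant multiset. Given $(b_v)_{v\in V}\in(\mathbb{F}_p^*)^V$ and $w\in V$, there exist $(\epsilon_v)_{v\in V\setminus\{w\}}\in[-r,r]^{V\setminus\{w\}}$ and $\epsilon_w\in[r]$ such that $$\epsilon_wb_ww=\sum_{v\in V\setminus\{w\}}\epsilon_vb_vv.$$
   Context: $[a,b]=\{a,\dots,b\}$ for integers $a<b$, $[r]=\{1,\dots,r\}$, integers viewed in $\mathbb{F}_p$. For a ring $R$, the group ring $R[\mathbb{F}_p^n]$ consists of formal sums $\sum_yr_yg^y$ ($r_y\in R$, $y\in\mathbb{F}_p^n$), with componentwise addition and multiplication determined by $g^ug^w=g^{u+w}$. Let $\lambda=e^{2\pi i/p}$. A multiset $V\subset\mathbb{F}_p^n$ is $(r,\mathbb{F}_p)$-vanishing if $\prod_{v\in V}(1-g^v)^r=0$ in $\mathbb{F}_p[\mathbb{F}_p^n]$, and $(r,\mathbb{F}_p)$-irredundant if it is $(r,\mathbb{F}_p)$-vanishing but no proper sub-multiset is. $V$ is $(r,\mathbb{C})$-irredundant if there exists $(t_v)_{v\in V}\in\mathbb{F}_p^V$ with $\prod_{v\in V}(1-\lambda^{t_v}g^v)^r=0$ in $\mathbb{C}[\mathbb{F}_p^n]$ but $\prod_{v\in V''}(1-\lambda^{t_v}g^v)^r\neq0$ for every proper sub-multiset $V''\subsetneq V$. Multisets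 are treated as indexed families; $V\setminus\{w\}$ removes one copy (the indexed element $w$); the empty product is $1$. -}

module Defs where

open import Data.Nat as ℕ using (ℕ; zero; suc)
open import Data.Nat.DivMod using (_%_; m%n<n)
open import Data.Integer as ℤ using (ℤ; +_; _-_; _*_; _+_)
open import Data.Integer.Divisibility as ℤD using ()
open import Data.Fin as Fin using (Fin; toℕ; fromℕ<)
import Data.Fin.Properties as FinP
open import Data.Vec as Vec using (Vec; zipWith; replicate)
open import Data.Vec.Properties using (≡-dec)
open import Data.List as List using (List; []; _∷_; _++_; foldr)
open import Data.Bool using (Bool; true; false; if_then_else_)
open import Data.Product using (Σ; _×_; _,_; ∃)
open import Relation.Nullary using (¬_; does)
open import Relation.Binary.PropositionalEquality using (_≡_; _≢_)

subF : {p : ℕ} → Fin p → Fin p → Fin p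
subF {suc q} a b = fromℕ< (m%n<n (toℕ a ℕ.+ (suc q ℕ.∸ toℕ b)) (suc q))

Pt : ℕ → ℕ → Set
Pt p n = Vec (Fin p) n

_-ᵥ_ : {p n : ℕ} → Pt p n → Pt p n → Pt p n
x -ᵥ y = zipWith subF x y

isZeroPt : {p n : ℕ} → Pt p n → Bool
isZeroPt {suc q} {n} x = does (≡-dec FinP._≟_ x (replicate n Fin.zero))
isZeroPt {zero}  {zero}  x = true
isZeroPt {zero}  {suc n} (() Vec.∷ _)

iter : {A : Set} → ℕ → (A → A) → A → A
iter zero    f a = a
iter (suc k) f a = f (iter k f a)

-- Sub-multisets of an indexed family V : Fin m → A are given by a
-- selector S : Fin m → Bool; factors lists the selected members.
factors : {A : Set} {m : ℕ} → (Fin m → A) → (Fin m → Bool) → List A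
factors {m = zero}  V S = []
factors {m = suc m} V S =
  (if S Fin.zero then V Fin.zero ∷ [] else []) ++ factors (λ i → V (Fin.suc i)) (λ i → S (Fin.suc i))

allSel : {m : ℕ} → Fin m → Bool
allSel _ = true

Proper : {m : ℕ} → (Fin m → Bool) → Set
Proper {m} S = ∃ λ (i : Fin m) → S i ≡ false

-- An element is its coefficient function
-- y ↦ r_y, with coefficients in ℤ (reduced mod p when testing zero;
-- reduction ℤ → F_p is a ring map so this computes in F_p[F_p^n]).

GRp : ℕ → ℕ → Set
GRp p n = Pt p n → ℤ

oneGRp : {p n : ℕ} → GRp p n
oneGRp y = if isZeroPt y then + 1 else + 0

mul1-gv : {p n : ℕ} → Pt p n → GRp p n → GRp p n
mul1-gv v f y = f y - f (y -ᵥ v)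

prodFp : {p n : ℕ} → ℕ → List (Pt p n) → GRp p n
prodFp r L = foldr (λ v f → iter r (mul1-gv v) f) oneGRp L

IsZeroFp : {p n : ℕ} → GRp p n → Set
IsZeroFp {p} f = ∀ y → (+ p) ℤD.∣ f y

VanishingFp : {p n m : ℕ} → ℕ → (Fin m → Pt p n) → (Fin m → Bool) → Set
VanishingFp r V S = IsZeroFp (prodFp r (factors V S))

IrredundantFp : {p n m : ℕ} → ℕ → (Fin m → Pt p n) → Set
IrredundantFp r V =
  VanishingFp r V allSel × (∀ S → Proper S → ¬ VanishingFp r V S)

-- The group ring C[F_p^n], restricted to the subring Z[λ][F_p^n],
-- λ = e^{2πi/p}, in which all products below live.  An element of Z[λ]
-- is written Σ_{j<p} c_j λ^j with c : Fin p → ℤ; such a sum is 0 in C iff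
-- c is constant (the only Q-linear relation among 1,λ,…,λ^{p-1} is
-- 1+λ+…+λ^{p-1}=0, p prime).

GRC : ℕ → ℕ → Set
GRC p n = Pt p n → Fin p → ℤ

oneGRC : {p n : ℕ} → GRC p n
oneGRC y j = if isZeroPt y then (if does (toℕ j ℕ.≟ 0) then + 1 else + 0) else + 0

mul1-λgv : {p n : ℕ} → Fin p × Pt p n → GRC p n → GRC p n
mul1-λgv (t , v) f y j = f y j - f (y -ᵥ v) (subF j t)

prodC : {p n : ℕ} → ℕ → List (Fin p × Pt p n) → GRC p n
prodC r L = foldr (λ tv f → iter r (mul1-λgv tv) f) oneGRC L

IsZeroC : {p n : ℕ} → GRC p n → Set
IsZeroC {p} f = ∀ y (j k : Fin p) → f y j ≡ f y k

VanishingC : {p n m : ℕ} → ℕ → (Fin m → Fin p) → (Fin m → Pt p n) → (Fin m → Bool) → Set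
VanishingC r t V S = IsZeroC (prodC r (factors (λ i → t i , V i) S))

IrredundantC : {p n m : ℕ} → ℕ → (Fin m → Pt p n) → Set
IrredundantC {p} {n} {m} r V = Σ (Fin m → Fin p) λ t →
  VanishingC r t V allSel × (∀ S → Proper S → ¬ VanishingC r t V S)

sumAll : {k : ℕ} → (Fin k → ℤ) → ℤ
sumAll {zero}  h = + 0
sumAll {suc k} h = h Fin.zero + sumAll (λ i → h (Fin.suc i))

sumExcept : {m : ℕ} → Fin m → (Fin m → ℤ) → ℤ
sumExcept w f = sumAll (λ i → if does (i FinP.≟ w) then + 0 else f i)

ι : {p : ℕ} → Fin p → ℤ
ι a = + toℕ a

{-# OPTIONS --safe #-}
module Submission where

-- Write T_v = 1 - λ^(t_v) g^v (with t_v = 0 over F_p) and T′_v = 1 - (λ^(t_v) g^v)^(b_v).  Since b_v is a unit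
-- mod p, T_v and T′_v divide each other (by geometric sums), so ∏ T′_v^r = 0 while ∏_{v ≠ w} T′_v^r ≠ 0.  Hence
-- for some k < r the element Q_k = T′_w^k ∏_{v ≠ w} T′_v^r is nonzero but T′_w Q_k = 0: Q_k is invariant under
-- translation by b_w w.  Every point of its support is Σ a_v b_v v with 0 ≤ a_v ≤ r and a_w ≤ k.  Along the
-- orbit y, y - b_w w, y - 2 b_w w, … of a support point the w-coefficients cannot decrease forever, and two
-- consecutive representations a, a′ with a_w ≤ a′_w give (1 + a′_w - a_w) b_w w = Σ_{v ≠ w} (a_v - a′_v) b_v v.

open import Defs
open import Data.Nat using (ℕ; _≤_; _<_)
open import Data.Nat.Primality using (Prime)
open import Data.Integer as ℤ using (ℤ; +_; -_; _*_; _-_)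
open import Data.Integer.Divisibility as ℤD using ()
open import Data.Fin using (Fin; toℕ)
open import Data.Vec using (lookup)
open import Data.Product using (Σ; _×_)
open import Data.Sum using (_⊎_)
open import Relation.Binary.PropositionalEquality using (_≢_)

open import Data.Bool using (Bool; true; false; if_then_else_)
open import Data.Bool.Properties using (if-eta)
open import Data.Fin using (zero; suc)
import Data.Fin.Properties as Fin
open import Data.Integer using (_+_; _⊖_; +≤+)
open import Data.Integer.Divisibility.Signed
  using (_∣_; _∣?_; divides; ∣m∣n⇒∣m+n; ∣m∣n⇒∣m-n; ∣m⇒∣-m; ∣m⇒∣m*n; ∣⇒∣ᵤ; ∣ᵤ⇒∣)
import Data.Integer.Properties as ℤP
open import Data.Integer.Tactic.RingSolver using (solve-∀)
open import Data.List using (List; []; _∷_; _++_; foldr)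
open import Data.Nat as ℕ using (zero; suc; z≤n; s≤s)
open import Data.Nat.Coprimality using (prime⇒coprime; coprime-Bézout) renaming (sym to coprime-sym)
open import Data.Nat.Divisibility using (n∣m⇒m%n≡0)
open import Data.Nat.DivMod using (_%_; _/_; m%n<n; m≡m%n+[m/n]*n; m<n⇒m%n≡m)
open import Data.Nat.GCD using (module Bézout)
import Data.Nat.Properties as ℕ
open import Data.Product using (∃; ∃-syntax; _,_; proj₁; proj₂)
open import Data.Sum using (inj₁; inj₂; [_,_]′)
open import Data.Vec using ([]; _∷_; tabulate; replicate)
open import Data.Vec.Functional using (updateAt)
import Data.Vec.Functional as VF
open import Data.Vec.Functional.Properties using (updateAt-updates; updateAt-minimal)
open import Data.Vec.Properties
  using (lookup-zipWith; lookup-replicate; tabulate∘lookup; tabulate-cong; ≡-dec)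
open import Function using (_∘_; id; case_of_)
open import Relation.Binary.Bundles using (Setoid)
open import Relation.Binary.PropositionalEquality
open import Algebra.Definitions {A = ℤ} _≡_ using (Interchangable)
open import Relation.Nullary using (¬_; Dec; yes; no; contradiction)
open import Relation.Unary using (Decidable)

private variable
  a b c d x y z : ℤ
  k m n p : ℕ

infix 4 _≡_mod_
data _≡_mod_ (x y : ℤ) (p : ℕ) : Set where
  congruent : + p ∣ x - y → x ≡ y mod p

≡⇒≡-mod : x ≡ y → x ≡ y mod p
≡⇒≡-mod {x = x} refl = congruent (divides (+ 0) (ℤP.+-inverseʳ x))

≡-mod-sym : x ≡ y mod p → y ≡ x mod p
≡-mod-sym {x = x} {y = y} (congruent p∣x-y) =
  congruent (subst (_ ∣_) (negate x y) (∣m⇒∣-m p∣x-y))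
  where
  negate : ∀ x y → - (x - y) ≡ y - x
  negate = solve-∀

≡-mod-trans : x ≡ y mod p → y ≡ z mod p → x ≡ z mod p
≡-mod-trans {x = x} {y = y} {z = z} (congruent p∣x-y) (congruent p∣y-z) =
  congruent (subst (_ ∣_) (telescope x y z) (∣m∣n⇒∣m+n p∣x-y p∣y-z))
  where
  telescope : ∀ x y z → (x - y) + (y - z) ≡ x - z
  telescope = solve-∀

≡-mod-setoid : ℕ → Setoid _ _
≡-mod-setoid p = record
  { Carrier       = ℤ
  ; _≈_           = _≡_mod p
  ; isEquivalence = record { refl = ≡⇒≡-mod refl ; sym = ≡-mod-sym ; trans = ≡-mod-trans }
  }

-‿cong-mod : a ≡ b mod p → c ≡ d mod p → a - c ≡ b - d mod p
-‿cong-mod {a = a} {b = b} {c = c} {d = d} (congruent p∣a-b) (congruent p∣c-d) =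
  congruent (subst (_ ∣_) (interchange a b c d) (∣m∣n⇒∣m-n p∣a-b p∣c-d))
  where
  interchange : ∀ a b c d → (a - b) - (c - d) ≡ (a - c) - (b - d)
  interchange = solve-∀

-‿congˡ-mod : ∀ a → b ≡ c mod p → a - b ≡ a - c mod p
-‿congˡ-mod a = -‿cong-mod (≡⇒≡-mod {x = a} refl)

-‿congʳ-mod : ∀ c → a ≡ b mod p → a - c ≡ b - c mod p
-‿congʳ-mod c a≡b = -‿cong-mod a≡b (≡⇒≡-mod {x = c} refl)

+-congʳ-mod : ∀ c → a ≡ b mod p → a + c ≡ b + c mod p
+-congʳ-mod {a = a} {b = b} c (congruent p∣a-b) = congruent (subst (_ ∣_) (cancel a b c) p∣a-b)
  where
  cancel : ∀ a b c → a - b ≡ (a + c) - (b + c)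
  cancel = solve-∀

*-congʳ-mod : ∀ c → a ≡ b mod p → a * c ≡ b * c mod p
*-congʳ-mod {a = a} {b = b} c (congruent p∣a-b) =
  congruent (subst (_ ∣_) (distrib a b c) (∣m⇒∣m*n c p∣a-b))
  where
  distrib : ∀ a b c → (a - b) * c ≡ a * c - b * c
  distrib = solve-∀

+-multiple-mod : ∀ k → x + k * + p ≡ x mod p
+-multiple-mod {x = x} k = congruent (divides k (cancel x (k * _)))
  where
  cancel : ∀ x y → x + y - x ≡ y
  cancel = solve-∀

ι-subF : (a b : Fin p) → ι (subF a b) ≡ ι a - ι b mod p
ι-subF {suc q} a b = begin
  + toℕ (subF a b)                         ≡⟨ cong +_ (Fin.toℕ-fromℕ< (m%n<n s (suc q))) ⟩
  + (s % suc q)                            ≈⟨ +-multiple-mod (+ (s / suc q)) ⟨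
  + (s % suc q) + + (s / suc q) * + suc q  ≡⟨ division ⟨
  + s                                      ≡⟨ ℤP.pos-+ (toℕ a) (suc q ℕ.∸ toℕ b) ⟩
  ι a + + (suc q ℕ.∸ toℕ b)                ≡⟨ cong (_+_ (ι a)) (ℤP.⊖-≥ (ℕ.<⇒≤ (Fin.toℕ<n b))) ⟨
  ι a + (suc q ⊖ toℕ b)                    ≡⟨ cong (_+_ (ι a)) (ℤP.m-n≡m⊖n (suc q) (toℕ b)) ⟨
  ι a + (+ suc q - ι b)                    ≡⟨ rearrange (ι a) (ι b) (+ suc q) ⟩
  ι a - ι b + + 1 * + suc q                ≈⟨ +-multiple-mod (+ 1) ⟩
  ι a - ι b                                ∎
  where
  open import Relation.Binary.Reasoning.Setoid (≡-mod-setoid (suc q))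
  s = toℕ a ℕ.+ (suc q ℕ.∸ toℕ b)
  division : + s ≡ + (s % suc q) + + (s / suc q) * + suc q
  division = trans (cong +_ (m≡m%n+[m/n]*n s (suc q)))
    (trans (ℤP.pos-+ (s % suc q) _) (cong (_+_ (+ (s % suc q))) (ℤP.pos-* (s / suc q) (suc q))))
  rearrange : ∀ a b p → a + (p - b) ≡ a - b + + 1 * p
  rearrange = solve-∀

residues-distinct : ∀ {m n} → n ≤ m → m < p → + m ≡ + n mod p → m ≡ n
residues-distinct {p = suc _} {m} {n} n≤m m<p (congruent p∣m-n) =
  ℕ.≤-antisym (ℕ.m∸n≡0⇒m≤n m∸n≡0) n≤m
  where
  m∸n≡0 : m ℕ.∸ n ≡ 0
  m∸n≡0 = trans (sym (m<n⇒m%n≡m (ℕ.≤-<-trans (ℕ.m∸n≤m m n) m<p)))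
                (n∣m⇒m%n≡0 _ _ (∣⇒∣ᵤ (subst (_ ∣_) (trans (ℤP.m-n≡m⊖n m n) (ℤP.⊖-≥ n≤m)) p∣m-n)))

ι-injective-mod : {a b : Fin p} → ι a ≡ ι b mod p → a ≡ b
ι-injective-mod {a = a} {b} a≡b with ℕ.≤-total (toℕ b) (toℕ a)
... | inj₁ b≤a = Fin.toℕ-injective (residues-distinct b≤a (Fin.toℕ<n a) a≡b)
... | inj₂ a≤b = Fin.toℕ-injective (sym (residues-distinct a≤b (Fin.toℕ<n b) (≡-mod-sym a≡b)))

inverse-mod : Prime p → ∀ {β} → β ≢ 0 → β < p → ∃[ c ] + (c ℕ.* β) ≡ + 1 mod p
inverse-mod {p = suc q} p-prime {β} β≢0 β<p
  with coprime-Bézout (coprime-sym (prime⇒coprime p-prime {{ℕ.≢-nonZero β≢0}} β<p))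
... | Bézout.+- x y 1+yp≡xβ = x , (begin
  + (x ℕ.* β)              ≡⟨ cong +_ 1+yp≡xβ ⟨
  + (1 ℕ.+ y ℕ.* suc q)    ≡⟨ cong (_+_ (+ 1)) (ℤP.pos-* y (suc q)) ⟩
  + 1 + + y * + suc q      ≈⟨ +-multiple-mod (+ y) ⟩
  + 1                      ∎)
  where open import Relation.Binary.Reasoning.Setoid (≡-mod-setoid (suc q))
... | Bézout.-+ x y 1+xβ≡yp = x ℕ.* q , (begin
  + (x ℕ.* q ℕ.* β)                      ≡⟨ trans (ℤP.pos-* (x ℕ.* q) β) (cong (_* + β) (ℤP.pos-* x q)) ⟩
  + x * + q * + β                        ≡⟨ expand (+ x) (+ q) (+ β) ⟩
  + q * (+ 1 + + x * + β) - + q          ≡⟨ cong (λ e → + q * e - + q) 1+xβ≡yp′ ⟩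
  + q * (+ y * (+ 1 + + q)) - + q        ≡⟨ collect (+ q) (+ y) ⟩
  + 1 + (+ q * + y - + 1) * + suc q      ≈⟨ +-multiple-mod (+ q * + y - + 1) ⟩
  + 1                                    ∎)
  where
  open import Relation.Binary.Reasoning.Setoid (≡-mod-setoid (suc q))
  1+xβ≡yp′ : + 1 + + x * + β ≡ + y * + suc q
  1+xβ≡yp′ = trans (cong (_+_ (+ 1)) (sym (ℤP.pos-* x β)))
                   (trans (cong +_ 1+xβ≡yp) (ℤP.pos-* y (suc q)))
  expand : ∀ x q β → x * q * β ≡ q * (+ 1 + x * β) - q
  expand = solve-∀
  collect : ∀ q y → q * (y * (+ 1 + q)) - q ≡ + 1 + (q * y - + 1) * (+ 1 + q)
  collect = solve-∀

-- Points of F_p^k through their integer coordinates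

coord : Pt p k → Fin k → ℤ
coord y i = ι (lookup y i)

coord-sub : (x y : Pt p k) (i : Fin k) → coord (x -ᵥ y) i ≡ coord x i - coord y i mod p
coord-sub {p = p} x y i =
  subst (λ e → ι e ≡ coord x i - coord y i mod p) (sym (lookup-zipWith subF i x y)) (ι-subF _ _)

coord-injective : {x y : Pt p k} → (∀ i → coord x i ≡ coord y i mod p) → x ≡ y
coord-injective {x = x} {y} x≡y = begin
  x                   ≡⟨ tabulate∘lookup x ⟨
  tabulate (lookup x) ≡⟨ tabulate-cong (ι-injective-mod ∘ x≡y) ⟩
  tabulate (lookup y) ≡⟨ tabulate∘lookup y ⟩
  y                   ∎
  where open ≡-Reasoning

coord-iter : (h : Pt p k → Pt p k) (s : Fin k → ℤ) → (∀ x i → coord (h x) i ≡ coord x i - s i mod p) →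
             ∀ c x i → coord (iter c h x) i ≡ coord x i - + c * s i mod p
coord-iter h s hs zero    x i = ≡⇒≡-mod (minus-zero (coord x i) (s i))
  where
  minus-zero : ∀ a s → a ≡ a - + 0 * s
  minus-zero = solve-∀
coord-iter {p = p} h s hs (suc c) x i = begin
  coord (h (iter c h x)) i            ≈⟨ hs (iter c h x) i ⟩
  coord (iter c h x) i - s i          ≈⟨ -‿congʳ-mod (s i) (coord-iter h s hs c x i) ⟩
  coord x i - + c * s i - s i         ≡⟨ collect (coord x i) (+ c) (s i) ⟩
  coord x i - (+ 1 + + c) * s i       ∎
  where
  open import Relation.Binary.Reasoning.Setoid (≡-mod-setoid p)
  collect : ∀ a c s → a - c * s - s ≡ a - (+ 1 + c) * s
  collect = solve-∀

coord-sub-iter : ∀ c (y v : Pt p k) i → coord (iter c (_-ᵥ v) y) i ≡ coord y i - + c * coord v i mod p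
coord-sub-iter c y v = coord-iter (_-ᵥ v) (coord v) (λ x → coord-sub x v) c y

-ᵥ-comm : (x u v : Pt p k) → (x -ᵥ u) -ᵥ v ≡ (x -ᵥ v) -ᵥ u
-ᵥ-comm {p = p} x u v = coord-injective λ i → begin
  coord ((x -ᵥ u) -ᵥ v) i         ≈⟨ coord-sub (x -ᵥ u) v i ⟩
  coord (x -ᵥ u) i - coord v i    ≈⟨ -‿congʳ-mod (coord v i) (coord-sub x u i) ⟩
  coord x i - coord u i - coord v i ≡⟨ swap (coord x i) (coord u i) (coord v i) ⟩
  coord x i - coord v i - coord u i ≈⟨ -‿congʳ-mod (coord u i) (coord-sub x v i) ⟨
  coord (x -ᵥ v) i - coord u i    ≈⟨ coord-sub (x -ᵥ v) u i ⟨
  coord ((x -ᵥ v) -ᵥ u) i         ∎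
  where
  open import Relation.Binary.Reasoning.Setoid (≡-mod-setoid p)
  swap : ∀ x u v → x - u - v ≡ x - v - u
  swap = solve-∀

iter-sub-∷ : ∀ c (t j : Fin p) (v y : Pt p k) →
             iter c (_-ᵥ (t ∷ v)) (j ∷ y) ≡ iter c (λ a → subF a t) j ∷ iter c (_-ᵥ v) y
iter-sub-∷ zero    t j v y = refl
iter-sub-∷ (suc c) t j v y = cong (_-ᵥ (t ∷ v)) (iter-sub-∷ c t j v y)

isZeroPt⇒coord≡0 : (y : Pt p k) → isZeroPt y ≡ true → ∀ i → coord y i ≡ + 0
isZeroPt⇒coord≡0 {p = suc q} {k} y y-zero i with ≡-dec Fin._≟_ y (replicate k zero)
... | yes refl = cong ι (lookup-replicate i zero)
... | no _     = contradiction y-zero λ ()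
isZeroPt⇒coord≡0 {p = zero} {suc k} (() ∷ _)

iter-sub-inverse : ∀ {c β} → + (c ℕ.* β) ≡ + 1 mod p → (g d : Pt p k) → iter c (iter β (_-ᵥ g)) d ≡ d -ᵥ g
iter-sub-inverse {p = p} {c = c} {β} cβ≡1 g d = coord-injective λ i → begin
  coord (iter c (iter β (_-ᵥ g)) d) i  ≈⟨ coord-iter _ (λ i → + β * coord g i) (λ x → coord-sub-iter β x g) c d i ⟩
  coord d i - + c * (+ β * coord g i)  ≡⟨ cong (_-_ (coord d i)) (reassociate (coord g i)) ⟩
  coord d i - + (c ℕ.* β) * coord g i  ≈⟨ -‿congˡ-mod (coord d i) (*-congʳ-mod (coord g i) cβ≡1) ⟩
  coord d i - + 1 * coord g i          ≡⟨ cong (_-_ (coord d i)) (ℤP.*-identityˡ (coord g i)) ⟩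
  coord d i - coord g i                ≈⟨ coord-sub d g i ⟨
  coord (d -ᵥ g) i                     ∎
  where
  open import Relation.Binary.Reasoning.Setoid (≡-mod-setoid p)
  reassociate : ∀ x → + c * (+ β * x) ≡ + (c ℕ.* β) * x
  reassociate x = trans (sym (ℤP.*-assoc (+ c) (+ β) x)) (cong (_* x) (sym (ℤP.pos-* c β)))

combination : (a β : Fin m → ℕ) → (Fin m → Pt p n) → Fin n → ℤ
combination a β V i = sumAll (λ j → + a j * + β j * coord (V j) i)

record Offset (y z : Pt p k) (s : Fin k → ℤ) : Set where
  constructor offset
  field coord-offset : ∀ i → coord y i ≡ coord z i + s i mod p

offset-refl : {y : Pt p k} → Offset y y (λ _ → + 0)
offset-refl = offset λ i → ≡⇒≡-mod (sym (ℤP.+-identityʳ _))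

offset-trans : {x y z : Pt p k} {s s′ : Fin k → ℤ} →
               Offset x y s → Offset y z s′ → Offset x z (λ i → s′ i + s i)
offset-trans {p = p} {x = x} {y} {z} {s} {s′} (offset x≡y+s) (offset y≡z+s′) = offset λ i → begin
  coord x i                  ≈⟨ x≡y+s i ⟩
  coord y i + s i            ≈⟨ +-congʳ-mod (s i) (y≡z+s′ i) ⟩
  coord z i + s′ i + s i     ≡⟨ ℤP.+-assoc (coord z i) (s′ i) (s i) ⟩
  coord z i + (s′ i + s i)   ∎
  where open import Relation.Binary.Reasoning.Setoid (≡-mod-setoid p)

offset-cong : {y z : Pt p k} {s s′ : Fin k → ℤ} → (∀ i → s i ≡ s′ i) → Offset y z s → Offset y z s′
offset-cong {p = p} {y = y} {z} s≡s′ (offset y≡z+s) =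
  offset λ i → subst (λ e → coord y i ≡ coord z i + e mod p) (s≡s′ i) (y≡z+s i)

iter-sub-offset : ∀ c (v y : Pt p k) → Offset y (iter c (_-ᵥ v) y) (λ i → + c * coord v i)
iter-sub-offset {p = p} c v y = offset λ i → begin
  coord y i                                      ≡⟨ cancel (coord y i) (+ c * coord v i) ⟩
  coord y i - + c * coord v i + + c * coord v i  ≈⟨ +-congʳ-mod (+ c * coord v i) (coord-sub-iter c y v i) ⟨
  coord (iter c (_-ᵥ v) y) i + + c * coord v i   ∎
  where
  open import Relation.Binary.Reasoning.Setoid (≡-mod-setoid p)
  cancel : ∀ x a → x ≡ x - a + a
  cancel = solve-∀

offset-difference : {y z : Pt p k} {s : Fin k → ℤ} →
                    Offset y z s → ∀ i → s i ≡ coord y i - coord z i mod p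
offset-difference {p = p} {y = y} {z} {s} (offset y≡z+s) i = begin
  s i                          ≡⟨ cancel (coord z i) (s i) ⟩
  coord z i + s i - coord z i  ≈⟨ -‿congʳ-mod (coord z i) (y≡z+s i) ⟨
  coord y i - coord z i        ∎
  where
  open import Relation.Binary.Reasoning.Setoid (≡-mod-setoid p)
  cancel : ∀ x a → a ≡ x + a - x
  cancel = solve-∀

offset-from-origin : {y z : Pt p k} {s : Fin k → ℤ} →
                     (∀ i → coord z i ≡ + 0) → Offset y z s → ∀ i → coord y i ≡ s i mod p
offset-from-origin {p = p} {y = y} {z} {s} z≡0 (offset y≡z+s) i = begin
  coord y i       ≈⟨ y≡z+s i ⟩
  coord z i + s i ≡⟨ cong (_+ s i) (z≡0 i) ⟩
  + 0 + s i       ≡⟨ ℤP.+-identityˡ (s i) ⟩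
  s i             ∎
  where open import Relation.Binary.Reasoning.Setoid (≡-mod-setoid p)

sumAll-cong : {f g : Fin m → ℤ} → (∀ i → f i ≡ g i) → sumAll f ≡ sumAll g
sumAll-cong {m = zero}  f≡g = refl
sumAll-cong {m = suc m} f≡g = cong₂ _+_ (f≡g zero) (sumAll-cong (f≡g ∘ suc))

sumAll-sub : (f g : Fin m → ℤ) → sumAll (λ i → f i - g i) ≡ sumAll f - sumAll g
sumAll-sub {m = zero}  f g = refl
sumAll-sub {m = suc m} f g =
  trans (cong (_+_ (f zero - g zero)) (sumAll-sub (f ∘ suc) (g ∘ suc)))
        (interchange (f zero) (g zero) _ _)
  where
  interchange : ∀ a b c d → a - b + (c - d) ≡ a + c - (b + d)
  interchange = solve-∀

sumAll-split : (w : Fin m) (f : Fin m → ℤ) → sumAll f ≡ f w + sumExcept w f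
sumAll-split zero    f = cong (_+_ (f zero)) (sym (ℤP.+-identityˡ _))
sumAll-split (suc w) f =
  trans (cong (_+_ (f zero)) (sumAll-split w (f ∘ suc))) (swap (f zero) (f (suc w)) _)
  where
  swap : ∀ a b c → a + (b + c) ≡ b + (a + c)
  swap = solve-∀

sumExcept-cong : (w : Fin m) {f g : Fin m → ℤ} → (∀ i → i ≢ w → f i ≡ g i) → sumExcept w f ≡ sumExcept w g
sumExcept-cong zero    f≡g = cong (_+_ (+ 0)) (sumAll-cong λ i → f≡g (suc i) λ ())
sumExcept-cong (suc w) f≡g =
  cong₂ _+_ (f≡g zero λ ()) (sumExcept-cong w λ i i≢w → f≡g (suc i) (i≢w ∘ Fin.suc-injective))

isolate : (w : Fin m) (δ B X : Fin m → ℤ) → B w * X w ≡ sumAll (λ i → δ i * B i * X i) mod p →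
          (+ 1 - δ w) * B w * X w - sumExcept w (λ i → δ i * B i * X i) ≡ + 0 mod p
isolate {p = p} w δ B X BX≡Σ = begin
  (+ 1 - δ w) * B w * X w - sumExcept w term  ≡⟨ expand (δ w) (B w) (X w) _ ⟩
  B w * X w - (term w + sumExcept w term)     ≡⟨ cong (_-_ (B w * X w)) (sumAll-split w term) ⟨
  B w * X w - sumAll term                     ≈⟨ -‿congʳ-mod (sumAll term) BX≡Σ ⟩
  sumAll term - sumAll term                   ≡⟨ ℤP.+-inverseʳ (sumAll term) ⟩
  + 0                                         ∎
  where
  open import Relation.Binary.Reasoning.Setoid (≡-mod-setoid p)
  term = λ i → δ i * B i * X i
  expand : ∀ δ B X s → (+ 1 - δ) * B * X - s ≡ B * X - (δ * B * X + s)
  expand = solve-∀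

Dependence : ℕ → (Fin m → Pt p n) → (Fin m → Fin p) → Fin m → Set
Dependence {m = m} {p = p} {n = n} r V b w = Σ (Fin m → ℤ) λ ε →
  ((+ 1 ℤ.≤ ε w) × (ε w ℤ.≤ + r)) ×
  (∀ i → i ≢ w → (- (+ r) ℤ.≤ ε i) × (ε i ℤ.≤ + r)) ×
  (∀ (k : Fin n) → + p ℤD.∣
    (ε w * ι (b w) * coord (V w) k - sumExcept w (λ i → ε i * ι (b i) * coord (V i) k)))

≡0-mod⇒∣ : x ≡ + 0 mod p → + p ℤD.∣ x
≡0-mod⇒∣ {x = x} (congruent p∣x-0) = ∣⇒∣ᵤ (subst (_ ∣_) (ℤP.+-identityʳ x) p∣x-0)

1-[m-n]≡1+[n∸m] : ∀ {a b} → a ≤ b → + 1 - (+ a - + b) ≡ + suc (b ℕ.∸ a)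
1-[m-n]≡1+[n∸m] {a} {b} a≤b =
  trans (rearrange (+ a) (+ b)) (cong (_+_ (+ 1)) (trans (ℤP.m-n≡m⊖n b a) (ℤP.⊖-≥ a≤b)))
  where
  rearrange : ∀ a b → + 1 - (a - b) ≡ + 1 + (b - a)
  rearrange = solve-∀

difference-bounds : ∀ {a b r} → a ≤ r → b ≤ r → (- (+ r) ℤ.≤ + a - + b) × (+ a - + b ℤ.≤ + r)
difference-bounds {a} {b} a≤r b≤r =
  ℤP.i≤j⇒i≤k+j (+ a) (ℤP.neg-mono-≤ (+≤+ b≤r)) , ℤP.i≤j⇒i-k≤j (+ b) (+≤+ a≤r)

dependence-of-difference : ∀ {r} (V : Fin m → Pt p n) (b : Fin m → Fin p) w (a₀ a₁ : Fin m → ℕ) →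
  (∀ i → a₀ i ≤ r) → (∀ i → a₁ i ≤ r) → a₀ w ≤ a₁ w → a₁ w < r →
  (∀ k → ι (b w) * coord (V w) k ≡ combination a₀ (toℕ ∘ b) V k - combination a₁ (toℕ ∘ b) V k mod p) →
  Dependence r V b w
dependence-of-difference {p = p} {r = r} V b w a₀ a₁ a₀≤r a₁≤r a₀w≤a₁w a₁w<r bv≡Σa₀-Σa₁ =
  ε , ε-w-bounds , ε-bounds , divisible
  where
  δ ε : Fin _ → ℤ
  δ i = + a₀ i - + a₁ i
  ε = updateAt δ w (_-_ (+ 1))

  ε-w-bounds : (+ 1 ℤ.≤ ε w) × (ε w ℤ.≤ + r)
  ε-w-bounds rewrite updateAt-updates w {_-_ (+ 1)} δ | 1-[m-n]≡1+[n∸m] a₀w≤a₁w =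
    +≤+ (s≤s z≤n) , +≤+ (ℕ.≤-trans (s≤s (ℕ.m∸n≤m (a₁ w) (a₀ w))) a₁w<r)

  ε-bounds : ∀ i → i ≢ w → (- (+ r) ℤ.≤ ε i) × (ε i ℤ.≤ + r)
  ε-bounds i i≢w rewrite updateAt-minimal i w {_-_ (+ 1)} δ i≢w = difference-bounds (a₀≤r i) (a₁≤r i)

  divisible : ∀ k → + p ℤD.∣
    (ε w * ι (b w) * coord (V w) k - sumExcept w (λ i → ε i * ι (b i) * coord (V i) k))
  divisible k = ≡0-mod⇒∣ (begin
    ε w * B w * X w - sumExcept w (λ i → ε i * B i * X i)
      ≡⟨ cong₂ (λ e s → e * B w * X w - s) (updateAt-updates w δ)
               (sumExcept-cong w λ i i≢w → cong (λ e → e * B i * X i) (updateAt-minimal i w δ i≢w)) ⟩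
    (+ 1 - δ w) * B w * X w - sumExcept w (λ i → δ i * B i * X i)
      ≈⟨ isolate w δ B X BX≡Σ ⟩
    + 0 ∎)
    where
    open import Relation.Binary.Reasoning.Setoid (≡-mod-setoid p)
    B X : Fin _ → ℤ
    B i = ι (b i)
    X i = coord (V i) k
    distribute : ∀ a₀ a₁ B X → (a₀ - a₁) * B * X ≡ a₀ * B * X - a₁ * B * X
    distribute = solve-∀
    BX≡Σ : B w * X w ≡ sumAll (λ i → δ i * B i * X i) mod p
    BX≡Σ = ≡-mod-trans (bv≡Σa₀-Σa₁ k)
             (≡⇒≡-mod (sym (trans (sumAll-cong λ i → distribute (+ a₀ i) (+ a₁ i) (B i) (X i))
                                   (sumAll-sub (λ i → + a₀ i * B i * X i) (λ i → + a₁ i * B i * X i)))))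

threshold : {P : ℕ → Set} → Decidable P → ∀ {r} → ¬ P 0 → P r → ∃[ k ] k < r × ¬ P k × P (suc k)
threshold P? {zero}  ¬P0 P0 = contradiction P0 ¬P0
threshold P? {suc r} ¬P0 P[1+r] with P? r
... | no ¬Pr = r , ℕ.≤-refl , ¬Pr , P[1+r]
... | yes Pr with threshold P? ¬P0 Pr
...   | k , k<r , ¬Pk , P[1+k] = k , ℕ.m≤n⇒m≤1+n k<r , ¬Pk , P[1+k]

non-decreasing-step : (f : ℕ → ℕ) → ∃[ j ] f j ≤ f (suc j)
non-decreasing-step f = below (f 0) f ℕ.≤-refl
  where
  below : ∀ N (f : ℕ → ℕ) → f 0 ≤ N → ∃[ j ] f j ≤ f (suc j)
  below N f f0≤N with f 0 ℕ.≤? f 1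
  ... | yes f0≤f1 = 0 , f0≤f1
  below zero    f f0≤0     | no f0≰f1 = contradiction (ℕ.≤-trans f0≤0 z≤n) f0≰f1
  below (suc N) f f0≤1+N   | no f0≰f1
    with below N (f ∘ suc) (ℕ.≤-pred (ℕ.≤-trans (ℕ.≰⇒> f0≰f1) f0≤1+N))
  ... | j , fj≤fj+1 = suc j , fj≤fj+1

∀⊎∃¬ : {P : Pt p k → Set} → Decidable P → (∀ y → P y) ⊎ ∃ λ y → ¬ P y
∀⊎∃¬ {k = zero} P? with P? []
... | yes P[] = inj₁ λ { [] → P[] }
... | no ¬P[] = inj₂ ([] , ¬P[])
∀⊎∃¬ {k = suc k} {P} P? = case Fin.any? counterexample-after? of λ where
    (yes (x , ys , ¬P)) → inj₂ (x ∷ ys , ¬P)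
    (no ∄)              → inj₁ λ { (x ∷ ys) →
      [ (λ all → all ys) , (λ counterexample → contradiction (x , counterexample) ∄) ]′ (∀⊎∃¬ (P? ∘ (x ∷_))) }
  where
  counterexample-after? : Decidable (λ x → ∃ λ ys → ¬ P (x ∷ ys))
  counterexample-after? x = [ (λ all → no λ (ys , ¬P) → ¬P (all ys)) , yes ]′ (∀⊎∃¬ (P? ∘ (x ∷_)))

-- Elements of ℤ[G] are kept as syntax so that their commutativity (⟦⟧-comm) can be proved by induction.
module ShiftOperators {D G : Set} (act : G → D → D)
                      (act-comm : ∀ g h d → act g (act h d) ≡ act h (act g d)) where

  infixl 6 _+ᴼ_ _-ᴼ_
  infixl 7 _*ᴼ_
  infixl 8 _^ᴼ_

  data Op : Set where
    1ᴼ             : Op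
    shift          : G → Op
    _*ᴼ_ _+ᴼ_ _-ᴼ_ : Op → Op → Op

  ⟦_⟧ : Op → (D → ℤ) → D → ℤ
  ⟦ 1ᴼ ⟧      f   = f
  ⟦ shift g ⟧ f   = f ∘ act g
  ⟦ A *ᴼ B ⟧  f   = ⟦ A ⟧ (⟦ B ⟧ f)
  ⟦ A +ᴼ B ⟧  f d = ⟦ A ⟧ f d + ⟦ B ⟧ f d
  ⟦ A -ᴼ B ⟧  f d = ⟦ A ⟧ f d - ⟦ B ⟧ f d

  _^ᴼ_ : Op → ℕ → Op
  A ^ᴼ zero  = 1ᴼ
  A ^ᴼ suc c = A ^ᴼ c *ᴼ A

  ⟦⟧-cong : ∀ A {f g} → f ≗ g → ⟦ A ⟧ f ≗ ⟦ A ⟧ g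
  ⟦⟧-cong 1ᴼ        f≗g   = f≗g
  ⟦⟧-cong (shift g) f≗g   = f≗g ∘ act g
  ⟦⟧-cong (A *ᴼ B)  f≗g   = ⟦⟧-cong A (⟦⟧-cong B f≗g)
  ⟦⟧-cong (A +ᴼ B)  f≗g d = cong₂ _+_ (⟦⟧-cong A f≗g d) (⟦⟧-cong B f≗g d)
  ⟦⟧-cong (A -ᴼ B)  f≗g d = cong₂ _-_ (⟦⟧-cong A f≗g d) (⟦⟧-cong B f≗g d)

  ⟦⟧-homomorphic : (_∙_ : ℤ → ℤ → ℤ) → Interchangable _+_ _∙_ → Interchangable _-_ _∙_ →
                   ∀ A f g → ⟦ A ⟧ (λ d → f d ∙ g d) ≗ λ d → ⟦ A ⟧ f d ∙ ⟦ A ⟧ g d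
  ⟦⟧-homomorphic _∙_ +-∙ -‿∙ 1ᴼ        f g d = refl
  ⟦⟧-homomorphic _∙_ +-∙ -‿∙ (shift h) f g d = refl
  ⟦⟧-homomorphic _∙_ +-∙ -‿∙ (A *ᴼ B)  f g d =
    trans (⟦⟧-cong A (⟦⟧-homomorphic _∙_ +-∙ -‿∙ B f g) d) (⟦⟧-homomorphic _∙_ +-∙ -‿∙ A _ _ d)
  ⟦⟧-homomorphic _∙_ +-∙ -‿∙ (A +ᴼ B)  f g d =
    trans (cong₂ _+_ (⟦⟧-homomorphic _∙_ +-∙ -‿∙ A f g d) (⟦⟧-homomorphic _∙_ +-∙ -‿∙ B f g d)) (+-∙ _ _ _ _)
  ⟦⟧-homomorphic _∙_ +-∙ -‿∙ (A -ᴼ B)  f g d =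
    trans (cong₂ _-_ (⟦⟧-homomorphic _∙_ +-∙ -‿∙ A f g d) (⟦⟧-homomorphic _∙_ +-∙ -‿∙ B f g d)) (-‿∙ _ _ _ _)

  ⟦⟧-additive : ∀ A f g → ⟦ A ⟧ (λ d → f d + g d) ≗ λ d → ⟦ A ⟧ f d + ⟦ A ⟧ g d
  ⟦⟧-additive = ⟦⟧-homomorphic _+_ sum-of-sums difference-of-sums
    where
    sum-of-sums : Interchangable _+_ _+_
    sum-of-sums = solve-∀
    difference-of-sums : Interchangable _-_ _+_
    difference-of-sums = solve-∀

  ⟦⟧-subtractive : ∀ A f g → ⟦ A ⟧ (λ d → f d - g d) ≗ λ d → ⟦ A ⟧ f d - ⟦ A ⟧ g d
  ⟦⟧-subtractive = ⟦⟧-homomorphic _-_ sum-of-differences difference-of-differences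
    where
    sum-of-differences : Interchangable _+_ _-_
    sum-of-differences = solve-∀
    difference-of-differences : Interchangable _-_ _-_
    difference-of-differences = solve-∀

  ⟦⟧-comm-shift : ∀ A g f → ⟦ A ⟧ (⟦ shift g ⟧ f) ≗ ⟦ shift g ⟧ (⟦ A ⟧ f)
  ⟦⟧-comm-shift 1ᴼ        g f d = refl
  ⟦⟧-comm-shift (shift h) g f d = cong f (act-comm g h d)
  ⟦⟧-comm-shift (A *ᴼ B)  g f d =
    trans (⟦⟧-cong A (⟦⟧-comm-shift B g f) d) (⟦⟧-comm-shift A g (⟦ B ⟧ f) d)
  ⟦⟧-comm-shift (A +ᴼ B)  g f d = cong₂ _+_ (⟦⟧-comm-shift A g f d) (⟦⟧-comm-shift B g f d)
  ⟦⟧-comm-shift (A -ᴼ B)  g f d = cong₂ _-_ (⟦⟧-comm-shift A g f d) (⟦⟧-comm-shift B g f d)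

  ⟦⟧-comm : ∀ A B f → ⟦ A ⟧ (⟦ B ⟧ f) ≗ ⟦ B ⟧ (⟦ A ⟧ f)
  ⟦⟧-comm A 1ᴼ        f d = refl
  ⟦⟧-comm A (shift g) f d = ⟦⟧-comm-shift A g f d
  ⟦⟧-comm A (B *ᴼ C)  f d = trans (⟦⟧-comm A B (⟦ C ⟧ f) d) (⟦⟧-cong B (⟦⟧-comm A C f) d)
  ⟦⟧-comm A (B +ᴼ C)  f d =
    trans (⟦⟧-additive A _ _ d) (cong₂ _+_ (⟦⟧-comm A B f d) (⟦⟧-comm A C f d))
  ⟦⟧-comm A (B -ᴼ C)  f d =
    trans (⟦⟧-subtractive A _ _ d) (cong₂ _-_ (⟦⟧-comm A B f d) (⟦⟧-comm A C f d))

  Acts : Op → (D → D) → Set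
  Acts A h = ∀ f d → ⟦ A ⟧ f d ≡ f (h d)

  ^ᴼ-acts : ∀ {A h} → Acts A h → ∀ c → Acts (A ^ᴼ c) (iter c h)
  ^ᴼ-acts A-acts zero    f d = refl
  ^ᴼ-acts A-acts (suc c) f d = trans (^ᴼ-acts A-acts c _ d) (A-acts f _)

  geom : Op → ℕ → Op
  geom M zero    = 1ᴼ -ᴼ 1ᴼ
  geom M (suc b) = geom M b +ᴼ M ^ᴼ b

  geom-telescopes : ∀ M b f → ⟦ geom M b ⟧ (⟦ 1ᴼ -ᴼ M ⟧ f) ≗ ⟦ 1ᴼ -ᴼ M ^ᴼ b ⟧ f
  geom-telescopes M zero    f d = trans (ℤP.+-inverseʳ (f d - ⟦ M ⟧ f d)) (sym (ℤP.+-inverseʳ (f d)))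
  geom-telescopes M (suc b) f d = begin
    ⟦ geom M b ⟧ (⟦ 1ᴼ -ᴼ M ⟧ f) d + ⟦ M ^ᴼ b ⟧ (⟦ 1ᴼ -ᴼ M ⟧ f) d
      ≡⟨ cong₂ _+_ (geom-telescopes M b f d) (⟦⟧-subtractive (M ^ᴼ b) f (⟦ M ⟧ f) d) ⟩
    (f d - ⟦ M ^ᴼ b ⟧ f d) + (⟦ M ^ᴼ b ⟧ f d - ⟦ M ^ᴼ b ⟧ (⟦ M ⟧ f) d)
      ≡⟨ telescope (f d) _ _ ⟩
    f d - ⟦ M ^ᴼ b ⟧ (⟦ M ⟧ f) d
      ∎
    where
    open ≡-Reasoning
    telescope : ∀ x y z → (x - y) + (y - z) ≡ x - z
    telescope = solve-∀

  prod : (Fin k → Op) → (Fin k → ℕ) → Op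
  prod {k = zero}  A e = 1ᴼ
  prod {k = suc k} A e = A zero ^ᴼ e zero *ᴼ prod (A ∘ suc) (e ∘ suc)

  prod-cong : ∀ (A : Fin k → Op) {e e′} → (∀ i → e i ≡ e′ i) → ∀ f → ⟦ prod A e ⟧ f ≗ ⟦ prod A e′ ⟧ f
  prod-cong {k = zero}  A e≡e′ f d = refl
  prod-cong {k = suc k} A {e} {e′} e≡e′ f d =
    trans (⟦⟧-cong (A zero ^ᴼ e zero) (prod-cong (A ∘ suc) (e≡e′ ∘ suc) f) d)
          (cong (λ c → ⟦ A zero ^ᴼ c ⟧ (⟦ prod (A ∘ suc) (e′ ∘ suc) ⟧ f) d) (e≡e′ zero))

  ^ᴼ-factor : ∀ {A U B} → (∀ f → ⟦ A ⟧ f ≗ ⟦ U ⟧ (⟦ B ⟧ f)) →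
              ∀ c f → ⟦ A ^ᴼ c ⟧ f ≗ ⟦ U ^ᴼ c ⟧ (⟦ B ^ᴼ c ⟧ f)
  ^ᴼ-factor A≗UB zero    f d = refl
  ^ᴼ-factor {A} {U} {B} A≗UB (suc c) f d = begin
    ⟦ A ^ᴼ c ⟧ (⟦ A ⟧ f) d                      ≡⟨ ^ᴼ-factor A≗UB c _ d ⟩
    ⟦ U ^ᴼ c ⟧ (⟦ B ^ᴼ c ⟧ (⟦ A ⟧ f)) d          ≡⟨ ⟦⟧-cong (U ^ᴼ c *ᴼ B ^ᴼ c) (A≗UB f) d ⟩
    ⟦ U ^ᴼ c ⟧ (⟦ B ^ᴼ c ⟧ (⟦ U ⟧ (⟦ B ⟧ f))) d  ≡⟨ ⟦⟧-cong (U ^ᴼ c) (⟦⟧-comm (B ^ᴼ c) U _) d ⟩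
    ⟦ U ^ᴼ c ⟧ (⟦ U ⟧ (⟦ B ^ᴼ c ⟧ (⟦ B ⟧ f))) d  ∎
    where open ≡-Reasoning

  prod-factor : (A U B : Fin k → Op) → (∀ i f → ⟦ A i ⟧ f ≗ ⟦ U i ⟧ (⟦ B i ⟧ f)) →
                ∀ e f → ⟦ prod A e ⟧ f ≗ ⟦ prod U e ⟧ (⟦ prod B e ⟧ f)
  prod-factor {k = zero}  A U B A≗UB e f d = refl
  prod-factor {k = suc k} A U B A≗UB e f d = begin
    ⟦ A₀ ⟧ (⟦ prod (A ∘ suc) e′ ⟧ f) d
      ≡⟨ ⟦⟧-cong A₀ (prod-factor (A ∘ suc) (U ∘ suc) (B ∘ suc) (A≗UB ∘ suc) e′ f) d ⟩
    ⟦ A₀ ⟧ (⟦ prod (U ∘ suc) e′ ⟧ (⟦ prod (B ∘ suc) e′ ⟧ f)) d     ≡⟨ ^ᴼ-factor (A≗UB zero) (e zero) _ d ⟩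
    ⟦ U₀ ⟧ (⟦ B₀ ⟧ (⟦ prod (U ∘ suc) e′ ⟧ (⟦ prod (B ∘ suc) e′ ⟧ f))) d
                                                                  ≡⟨ ⟦⟧-cong U₀ (⟦⟧-comm B₀ (prod (U ∘ suc) e′) _) d ⟩
    ⟦ U₀ ⟧ (⟦ prod (U ∘ suc) e′ ⟧ (⟦ B₀ ⟧ (⟦ prod (B ∘ suc) e′ ⟧ f))) d ∎
    where
    open ≡-Reasoning
    e′ = e ∘ suc
    A₀ = A zero ^ᴼ e zero
    U₀ = U zero ^ᴼ e zero
    B₀ = B zero ^ᴼ e zero

  prod-update : ∀ (A : Fin k → Op) w {e e′} → e′ w ≡ suc (e w) → (∀ i → i ≢ w → e′ i ≡ e i) →
                ∀ f → ⟦ prod A e′ ⟧ f ≗ ⟦ A w ⟧ (⟦ prod A e ⟧ f)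
  prod-update A zero {e} {e′} e′w≡1+ew e′i≡ei f d = begin
    ⟦ A zero ^ᴼ e′ zero ⟧ (⟦ prod (A ∘ suc) (e′ ∘ suc) ⟧ f) d
      ≡⟨ ⟦⟧-cong (A zero ^ᴼ e′ zero) (prod-cong (A ∘ suc) (λ i → e′i≡ei (suc i) λ ()) f) d ⟩
    ⟦ A zero ^ᴼ e′ zero ⟧ (⟦ prod (A ∘ suc) (e ∘ suc) ⟧ f) d
      ≡⟨ cong (λ c → ⟦ A zero ^ᴼ c ⟧ _ d) e′w≡1+ew ⟩
    ⟦ A zero ^ᴼ e zero ⟧ (⟦ A zero ⟧ (⟦ prod (A ∘ suc) (e ∘ suc) ⟧ f)) d
      ≡⟨ ⟦⟧-comm (A zero ^ᴼ e zero) (A zero) _ d ⟩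
    ⟦ A zero ⟧ (⟦ A zero ^ᴼ e zero ⟧ (⟦ prod (A ∘ suc) (e ∘ suc) ⟧ f)) d
      ∎
    where open ≡-Reasoning
  prod-update A (suc w) {e} {e′} e′w≡1+ew e′i≡ei f d = begin
    ⟦ A zero ^ᴼ e′ zero ⟧ (⟦ prod (A ∘ suc) (e′ ∘ suc) ⟧ f) d
      ≡⟨ ⟦⟧-cong (A zero ^ᴼ e′ zero) (prod-update (A ∘ suc) w e′w≡1+ew e′i≡ei′ f) d ⟩
    ⟦ A zero ^ᴼ e′ zero ⟧ (⟦ A (suc w) ⟧ (⟦ prod (A ∘ suc) (e ∘ suc) ⟧ f)) d
      ≡⟨ cong (λ c → ⟦ A zero ^ᴼ c ⟧ _ d) (e′i≡ei zero λ ()) ⟩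
    ⟦ A zero ^ᴼ e zero ⟧ (⟦ A (suc w) ⟧ (⟦ prod (A ∘ suc) (e ∘ suc) ⟧ f)) d
      ≡⟨ ⟦⟧-comm (A zero ^ᴼ e zero) (A (suc w)) _ d ⟩
    ⟦ A (suc w) ⟧ (⟦ A zero ^ᴼ e zero ⟧ (⟦ prod (A ∘ suc) (e ∘ suc) ⟧ f)) d
      ∎
    where
    open ≡-Reasoning
    e′i≡ei′ : ∀ i → i ≢ w → e′ (suc i) ≡ e (suc i)
    e′i≡ei′ i i≢w = e′i≡ei (suc i) (i≢w ∘ Fin.suc-injective)

-- Vanishing in F_p[F_p^n] and in ℤ[λ][F_p^n]

-- A function F_p^n × F_p → ℤ is stored on F_p^(n+1) with the power of λ as head coordinate, so that
-- shift (t ∷ v) is multiplication by λ^t g^v; over F_p the functions ignore the head coordinate.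
module Translations {p n : ℕ} = ShiftOperators {Pt p (suc n)} (λ g d → d -ᵥ g) (λ g h d → -ᵥ-comm d h g)

-- s : Fin p → ℤ stands for Σ_j s_j λ^j; IsZero s says that it vanishes in F_p, respectively in ℂ.
record ZeroTest (p : ℕ) : Set₁ where
  field
    IsZero      : (Fin p → ℤ) → Set
    isZero?     : Decidable IsZero
    IsZero-resp : ∀ {s s′} → s ≗ s′ → IsZero s → IsZero s′
    IsZero-∘    : ∀ {s} (π : Fin p → Fin p) → IsZero s → IsZero (s ∘ π)
    IsZero-0    : IsZero (λ _ → + 0)
    IsZero-sub  : ∀ {s s′} → IsZero s → IsZero s′ → IsZero (λ j → s j - s′ j)

  IsZero-add : ∀ {s s′} → IsZero s → IsZero s′ → IsZero (λ j → s j + s′ j)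
  IsZero-add {s} {s′} zs zs′ =
    IsZero-resp (λ j → minus-minus (s j) (s′ j)) (IsZero-sub zs (IsZero-sub IsZero-0 zs′))
    where
    minus-minus : ∀ a b → a - (+ 0 - b) ≡ a + b
    minus-minus = solve-∀

  IsZero-cancel : ∀ {s s′} → IsZero (λ j → s j - s′ j) → IsZero s′ → IsZero s
  IsZero-cancel {s} {s′} zs-s′ zs′ = IsZero-resp (λ j → cancel (s j) (s′ j)) (IsZero-add zs-s′ zs′)
    where
    cancel : ∀ a b → a - b + b ≡ a
    cancel = solve-∀

Fp-zero : ZeroTest p
Fp-zero {p} = record
  { IsZero      = λ s → ∀ j → + p ∣ s j
  ; isZero?     = λ s → Fin.all? (λ j → + p ∣? s j)
  ; IsZero-resp = λ s≗s′ zs j → subst (_ ∣_) (s≗s′ j) (zs j)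
  ; IsZero-∘    = λ π zs j → zs (π j)
  ; IsZero-0    = λ j → divides (+ 0) refl
  ; IsZero-sub  = λ zs zs′ j → ∣m∣n⇒∣m-n (zs j) (zs′ j)
  }

ℂ-zero : ZeroTest p
ℂ-zero = record
  { IsZero      = λ s → ∀ j k → s j ≡ s k
  ; isZero?     = λ s → Fin.all? λ j → Fin.all? λ k → s j ℤ.≟ s k
  ; IsZero-resp = λ s≗s′ zs j k → trans (sym (s≗s′ j)) (trans (zs j k) (s≗s′ k))
  ; IsZero-∘    = λ π zs j k → zs (π j) (π k)
  ; IsZero-0    = λ j k → refl
  ; IsZero-sub  = λ zs zs′ j k → cong₂ _-_ (zs j k) (zs′ j k)
  }

allBut : Fin m → Fin m → Bool
allBut w = updateAt (λ _ → true) w (λ _ → false)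

module Vanishing {p n : ℕ} (Z : ZeroTest p) where
  open ZeroTest Z
  open Translations {p} {n} public

  Fn : Set
  Fn = Pt p (suc n) → ℤ

  slice : Fn → Pt p n → Fin p → ℤ
  slice f y j = f (j ∷ y)

  Vanishes : Fn → Set
  Vanishes f = ∀ y → IsZero (slice f y)

  NonzeroAt : Fn → Pt p n → Set
  NonzeroAt f y = ¬ IsZero (slice f y)

  Δ : Pt p (suc n) → ℕ → Op
  Δ g β = 1ᴼ -ᴼ shift g ^ᴼ β

  vanishes-resp : ∀ {f g} → f ≗ g → Vanishes f → Vanishes g
  vanishes-resp f≗g f-vanishes y = IsZero-resp (λ j → f≗g (j ∷ y)) (f-vanishes y)

  vanishes-⟦⟧ : ∀ A {f} → Vanishes f → Vanishes (⟦ A ⟧ f)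
  vanishes-⟦⟧ 1ᴼ              f-vanishes   = f-vanishes
  vanishes-⟦⟧ (shift (t ∷ v)) f-vanishes y = IsZero-∘ (λ j → subF j t) (f-vanishes (y -ᵥ v))
  vanishes-⟦⟧ (A *ᴼ B)        f-vanishes   = vanishes-⟦⟧ A (vanishes-⟦⟧ B f-vanishes)
  vanishes-⟦⟧ (A +ᴼ B)        f-vanishes y =
    IsZero-add (vanishes-⟦⟧ A f-vanishes y) (vanishes-⟦⟧ B f-vanishes y)
  vanishes-⟦⟧ (A -ᴼ B)        f-vanishes y =
    IsZero-sub (vanishes-⟦⟧ A f-vanishes y) (vanishes-⟦⟧ B f-vanishes y)

  vanishes⊎nonzero : ∀ f → Vanishes f ⊎ ∃ (NonzeroAt f)
  vanishes⊎nonzero f = ∀⊎∃¬ (isZero? ∘ slice f)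

  vanishes? : ∀ f → Dec (Vanishes f)
  vanishes? f = [ yes , (λ (y , nonzero) → no λ vanishing → nonzero (vanishing y)) ]′ (vanishes⊎nonzero f)

  nonvanishing⇒nonzero : ∀ {f} → ¬ Vanishes f → ∃ (NonzeroAt f)
  nonvanishing⇒nonzero {f} ¬vanishing =
    [ (λ vanishing → contradiction vanishing ¬vanishing) , id ]′ (vanishes⊎nonzero f)

  vanishes-factor : (A U B : Fin k → Op) → (∀ i f → ⟦ A i ⟧ f ≗ ⟦ U i ⟧ (⟦ B i ⟧ f)) →
                    ∀ e {f} → Vanishes (⟦ prod B e ⟧ f) → Vanishes (⟦ prod A e ⟧ f)
  vanishes-factor A U B A≗UB e {f} B-vanishes =
    vanishes-resp (λ d → sym (prod-factor A U B A≗UB e f d)) (vanishes-⟦⟧ (prod U e) B-vanishes)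

  slice-shift^ : ∀ t v β f y →
                 slice (⟦ shift (t ∷ v) ^ᴼ β ⟧ f) y ≗ slice f (iter β (_-ᵥ v) y) ∘ iter β (λ j → subF j t)
  slice-shift^ t v β f y j = trans (^ᴼ-acts (λ _ _ → refl) β f (j ∷ y)) (cong f (iter-sub-∷ β t j v y))

  Δ-nonzero⇒nonzero : ∀ t v β {f y} → NonzeroAt (⟦ Δ (t ∷ v) β ⟧ f) y →
                      NonzeroAt f y ⊎ NonzeroAt f (iter β (_-ᵥ v) y)
  Δ-nonzero⇒nonzero t v β {f} {y} nonzero = case isZero? (slice f y) of λ where
    (no ¬f-zero) → inj₁ ¬f-zero
    (yes f-zero) → inj₂ λ f′-zero → nonzero
      (IsZero-resp (λ j → cong (_-_ (slice f y j)) (sym (slice-shift^ t v β f y j)))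
                   (IsZero-sub f-zero (IsZero-∘ (iter β (λ j → subF j t)) f′-zero)))

  Δ-vanishes⇒nonzero-invariant : ∀ t v β {f y} → Vanishes (⟦ Δ (t ∷ v) β ⟧ f) →
                                 NonzeroAt f y → NonzeroAt f (iter β (_-ᵥ v) y)
  Δ-vanishes⇒nonzero-invariant t v β {f} {y} Δf-vanishes ¬f-zero f′-zero = ¬f-zero (IsZero-cancel
    (IsZero-resp (λ j → cong (_-_ (slice f y j)) (slice-shift^ t v β f y j)) (Δf-vanishes y))
    (IsZero-∘ (iter β (λ j → subF j t)) f′-zero))

  unit-support : ∀ (c : Fin p → ℤ) {z : Pt p n} →
                 ¬ IsZero (λ j → if isZeroPt z then c j else + 0) → ∀ i → coord z i ≡ + 0
  unit-support c {z} nonzero with isZeroPt z in z-zero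
  ... | false = contradiction IsZero-0 nonzero
  ... | true  = isZeroPt⇒coord≡0 z z-zero

  support-^ᴼ : ∀ t v β e {f} y → NonzeroAt (⟦ Δ (t ∷ v) β ^ᴼ e ⟧ f) y →
              ∃ λ a → a ≤ e × ∃ λ z → NonzeroAt f z × Offset y z (λ i → + a * + β * coord v i)
  support-^ᴼ t v β zero    y nonzero = 0 , z≤n , y , nonzero , offset-refl
  support-^ᴼ t v β (suc e) {f} y nonzero = case support-^ᴼ t v β e y nonzero of λ where
      (a , a≤e , z , nonzero-z , y≡z+aβv) → case Δ-nonzero⇒nonzero t v β {f} {z} nonzero-z of λ where
        (inj₁ nonzero-f) → a , ℕ.m≤n⇒m≤1+n a≤e , z , nonzero-f , y≡z+aβv
        (inj₂ nonzero-f) → suc a , s≤s a≤e , iter β (_-ᵥ v) z , nonzero-f ,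
          offset-cong (λ i → one-more (+ a) (+ β) (coord v i))
                      (offset-trans y≡z+aβv (iter-sub-offset β v z))
    where
    one-more : ∀ a β v → β * v + a * β * v ≡ (+ 1 + a) * β * v
    one-more = solve-∀

  support-prod : ∀ (t : Fin m → Fin p) V β e {f} y → NonzeroAt (⟦ prod (λ i → Δ (t i ∷ V i) (β i)) e ⟧ f) y →
                 ∃ λ a → (∀ i → a i ≤ e i) × ∃ λ z → NonzeroAt f z × Offset y z (combination a β V)
  support-prod {m = zero}  t V β e y nonzero = (λ ()) , (λ ()) , y , nonzero , offset-refl
  support-prod {m = suc m} t V β e y nonzero = case support-^ᴼ (t zero) (V zero) (β zero) (e zero) y nonzero of λ where
    (a₀ , a₀≤e₀ , z₀ , nonzero-z₀ , y≡z₀+a₀β₀v₀) →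
      case support-prod (t ∘ suc) (V ∘ suc) (β ∘ suc) (e ∘ suc) z₀ nonzero-z₀ of λ where
        (a , a≤e , z , nonzero-z , z₀≡z+Σa) → a₀ VF.∷ a , (λ { zero → a₀≤e₀ ; (suc i) → a≤e i }) , z , nonzero-z ,
          offset-cong (λ i → ℤP.+-comm (combination a (β ∘ suc) (V ∘ suc) i) _)
                      (offset-trans y≡z₀+a₀β₀v₀ z₀≡z+Σa)

  module Irredundant {m} (p-prime : Prime p)
                     (f₀ : Fn) (f₀-at-origin : ∀ {z} → NonzeroAt f₀ z → ∀ i → coord z i ≡ + 0)
                     (t : Fin m → Fin p) (V : Fin m → Pt p n) (b : Fin m → Fin p) (b≢0 : ∀ i → toℕ (b i) ≢ 0)
                     (r : ℕ) (w : Fin m) where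

    β : Fin m → ℕ
    β = toℕ ∘ b

    T T′ : Fin m → Op
    T  i = Δ (t i ∷ V i) 1
    T′ i = Δ (t i ∷ V i) (β i)

    E : ℕ → Fin m → ℕ
    E k i = if allBut w i then r else k

    Q : ℕ → Fn
    Q k = ⟦ prod T′ (E k) ⟧ f₀

    b⁻¹ : ∀ i → ∃[ c ] + (c ℕ.* β i) ≡ + 1 mod p
    b⁻¹ i = inverse-mod p-prime (b≢0 i) (Fin.toℕ<n (b i))

    U U′ : Fin m → Op
    U  i = geom (shift (t i ∷ V i)) (β i)
    U′ i = geom (shift (t i ∷ V i) ^ᴼ β i) (proj₁ (b⁻¹ i))

    T′≗UT : ∀ i f → ⟦ T′ i ⟧ f ≗ ⟦ U i ⟧ (⟦ T i ⟧ f)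
    T′≗UT i f d = sym (geom-telescopes (shift (t i ∷ V i)) (β i) f d)

    T≗U′T′ : ∀ i f → ⟦ T i ⟧ f ≗ ⟦ U′ i ⟧ (⟦ T′ i ⟧ f)
    T≗U′T′ i f d = sym (trans (geom-telescopes (shift g ^ᴼ β i) γ f d) (cong (_-_ (f d)) (begin
      ⟦ shift g ^ᴼ β i ^ᴼ γ ⟧ f d        ≡⟨ ^ᴼ-acts (^ᴼ-acts (λ _ _ → refl) (β i)) γ f d ⟩
      f (iter γ (iter (β i) (_-ᵥ g)) d)  ≡⟨ cong f (iter-sub-inverse {c = γ} {β = β i} (proj₂ (b⁻¹ i)) g d) ⟩
      f (d -ᵥ g)                         ∎)))
      where
      open ≡-Reasoning
      g = t i ∷ V i
      γ = proj₁ (b⁻¹ i)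

    Q-vanishes : Vanishes (⟦ prod T (λ _ → r) ⟧ f₀) → Vanishes (Q r)
    Q-vanishes vanishing = vanishes-resp (prod-cong T′ (λ i → sym (if-eta (allBut w i))) f₀)
                                         (vanishes-factor T′ U T T′≗UT (λ _ → r) vanishing)

    Q₀-nonvanishing : ¬ Vanishes (⟦ prod T (E 0) ⟧ f₀) → ¬ Vanishes (Q 0)
    Q₀-nonvanishing ¬vanishing = ¬vanishing ∘ vanishes-factor T U′ T′ T≗U′T′ (E 0)

    E-w : ∀ k → E k w ≡ k
    E-w k = cong (λ s → if s then r else k) (updateAt-updates w (λ _ → true))

    E-i : ∀ k i → i ≢ w → E k i ≡ r
    E-i k i i≢w = cong (λ s → if s then r else k) (updateAt-minimal i w (λ _ → true) i≢w)

    E-≤ : ∀ {k} → k ≤ r → ∀ i → E k i ≤ r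
    E-≤ {k} k≤r i with i Fin.≟ w
    ... | yes refl = ℕ.≤-trans (ℕ.≤-reflexive (E-w k)) k≤r
    ... | no i≢w   = ℕ.≤-reflexive (E-i k i i≢w)

    Q-suc : ∀ k → Q (suc k) ≗ ⟦ T′ w ⟧ (Q k)
    Q-suc k = prod-update T′ w (trans (E-w (suc k)) (cong suc (sym (E-w k))))
                          (λ i i≢w → trans (E-i (suc k) i i≢w) (sym (E-i k i i≢w))) f₀

    Q-support : ∀ {k y} → NonzeroAt (Q k) y →
                ∃ λ a → (∀ i → a i ≤ E k i) × ∀ i → coord y i ≡ combination a β V i mod p
    Q-support {k} nonzero = case support-prod t V β (E k) _ nonzero of λ where
      (a , a≤E , z , nonzero-z , y≡z+Σa) → a , a≤E , offset-from-origin (f₀-at-origin nonzero-z) y≡z+Σa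

    module Orbit {k} (k<r : k < r) (invariant : Vanishes (⟦ T′ w ⟧ (Q k)))
                 {y₀} (nonzero-y₀ : NonzeroAt (Q k) y₀) where
      orbit : ℕ → Pt p n
      orbit j = iter j (iter (β w) (_-ᵥ V w)) y₀

      orbit-nonzero : ∀ j → NonzeroAt (Q k) (orbit j)
      orbit-nonzero zero    = nonzero-y₀
      orbit-nonzero (suc j) =
        Δ-vanishes⇒nonzero-invariant (t w) (V w) (β w) {Q k} {orbit j} invariant (orbit-nonzero j)

      step : ∀ j i → ι (b w) * coord (V w) i ≡ coord (orbit j) i - coord (orbit (suc j)) i mod p
      step j = offset-difference (iter-sub-offset (β w) (V w) (orbit j))

      representation : ∀ j →
        ∃ λ a → (∀ i → a i ≤ E k i) × ∀ i → coord (orbit j) i ≡ combination a β V i mod p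
      representation j = Q-support (orbit-nonzero j)

      coefficients : ℕ → Fin m → ℕ
      coefficients j = proj₁ (representation j)

      coefficients≤r : ∀ j i → coefficients j i ≤ r
      coefficients≤r j i = ℕ.≤-trans (proj₁ (proj₂ (representation j)) i) (E-≤ (ℕ.<⇒≤ k<r) i)

      coefficients-w<r : ∀ j → coefficients j w < r
      coefficients-w<r j =
        ℕ.≤-<-trans (subst (coefficients j w ≤_) (E-w k) (proj₁ (proj₂ (representation j)) w)) k<r

      orbit≡Σcoefficients : ∀ j i → coord (orbit j) i ≡ combination (coefficients j) β V i mod p
      orbit≡Σcoefficients j = proj₂ (proj₂ (representation j))

      dependence : Dependence r V b w
      dependence = case non-decreasing-step (λ j → coefficients j w) of λ where
        (j , nondecreasing) →
          dependence-of-difference V b w (coefficients j) (coefficients (suc j))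
            (coefficients≤r j) (coefficients≤r (suc j)) nondecreasing (coefficients-w<r (suc j))
            λ i → ≡-mod-trans (step j i) (-‿cong-mod (orbit≡Σcoefficients j i) (orbit≡Σcoefficients (suc j) i))

    dependence : Vanishes (⟦ prod T (λ _ → r) ⟧ f₀) → ¬ Vanishes (⟦ prod T (E 0) ⟧ f₀) → Dependence r V b w
    dependence vanishing ¬vanishing =
      case threshold {P = Vanishes ∘ Q} (vanishes? ∘ Q) (Q₀-nonvanishing ¬vanishing) (Q-vanishes vanishing) of λ where
        (k , k<r , ¬Qk-vanishes , Q[1+k]-vanishes) → case nonvanishing⇒nonzero {Q k} ¬Qk-vanishes of λ where
          (y₀ , nonzero-y₀) →
            Orbit.dependence k<r (vanishes-resp {Q (suc k)} (Q-suc k) Q[1+k]-vanishes) {y₀} nonzero-y₀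

-- The group rings of the statement

exponent : ℕ → (Fin m → Bool) → Fin m → ℕ
exponent r S i = if S i then r else 0

fromFp : ∀ {p n} → GRp p n → Pt p (suc n) → ℤ
fromFp F (_ ∷ y) = F y

fromC : ∀ {p n} → GRC p n → Pt p (suc n) → ℤ
fromC F (j ∷ y) = F y j

module _ {p n : ℕ} {X A : Set} (embed : X → Pt p (suc n) → ℤ) (step : A → X → X) where
  open Translations {p} {n}

  module _ (T : A → Op) (step≗T : ∀ a F → embed (step a F) ≗ ⟦ T a ⟧ (embed F)) where

    iter≗^ᴼ : ∀ r a F → embed (iter r (step a) F) ≗ ⟦ T a ^ᴼ r ⟧ (embed F)
    iter≗^ᴼ zero    a F d = refl
    iter≗^ᴼ (suc r) a F d = begin
      embed (step a (iter r (step a) F)) d       ≡⟨ step≗T a _ d ⟩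
      ⟦ T a ⟧ (embed (iter r (step a) F)) d      ≡⟨ ⟦⟧-cong (T a) (iter≗^ᴼ r a F) d ⟩
      ⟦ T a ⟧ (⟦ T a ^ᴼ r ⟧ (embed F)) d         ≡⟨ ⟦⟧-comm (T a) (T a ^ᴼ r) _ d ⟩
      ⟦ T a ^ᴼ r ⟧ (⟦ T a ⟧ (embed F)) d         ∎
      where open ≡-Reasoning

    module _ (r : ℕ) where
      iterate-all : List A → X → X
      iterate-all L F = foldr (λ a → iter r (step a)) F L

      selected≗^ᴼ : ∀ s a L F → embed (iterate-all ((if s then a ∷ [] else []) ++ L) F) ≗
                                ⟦ T a ^ᴼ (if s then r else 0) ⟧ (embed (iterate-all L F))
      selected≗^ᴼ true  a L F = iter≗^ᴼ r a (iterate-all L F)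
      selected≗^ᴼ false a L F d = refl

      factors≗prod : ∀ (V : Fin m → A) S F →
                     embed (iterate-all (factors V S) F) ≗ ⟦ prod (T ∘ V) (exponent r S) ⟧ (embed F)
      factors≗prod {m = zero}  V S F d = refl
      factors≗prod {m = suc m} V S F d =
        trans (selected≗^ᴼ (S zero) (V zero) (factors (V ∘ suc) (S ∘ suc)) F d)
              (⟦⟧-cong (T (V zero) ^ᴼ exponent r S zero) (factors≗prod (V ∘ suc) (S ∘ suc) F) d)

allBut-proper : (w : Fin m) → Proper (allBut w)
allBut-proper w = w , updateAt-updates w (λ _ → true)

Fp-dependence : ∀ {q n m r} → Prime (suc q) → (V : Fin m → Pt (suc q) n) → IrredundantFp r V →
                (b : Fin m → Fin (suc q)) → (∀ i → toℕ (b i) ≢ 0) → ∀ w → Dependence r V b w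
Fp-dependence {q} {n} {r = r} p-prime V (vanishing , irredundant) b b≢0 w =
  Irredundant.dependence p-prime (fromFp oneGRp) (λ {z} → unit-support (λ _ → + 1) {z}) (λ _ → zero) V b b≢0 r w
    (vanishes-resp (bridge allSel) λ y j → ∣ᵤ⇒∣ (vanishing y))
    λ vanishes → irredundant (allBut w) (allBut-proper w)
                   λ y → ∣⇒∣ᵤ (vanishes-resp (sym ∘ bridge (allBut w)) vanishes y zero)
  where
  open Vanishing {suc q} {n} Fp-zero
  bridge : ∀ S → fromFp (prodFp r (factors V S)) ≗
                 ⟦ prod (λ i → Δ (zero ∷ V i) 1) (exponent r S) ⟧ (fromFp oneGRp)
  bridge S = factors≗prod fromFp mul1-gv (λ v → Δ (zero ∷ v) 1) (λ { v F (_ ∷ y) → refl }) r V S oneGRp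

ℂ-dependence : ∀ {p n m r} → Prime p → (V : Fin m → Pt p n) → IrredundantC r V →
               (b : Fin m → Fin p) → (∀ i → toℕ (b i) ≢ 0) → ∀ w → Dependence r V b w
ℂ-dependence {p} {n} {r = r} p-prime V (t , vanishing , irredundant) b b≢0 w =
  Irredundant.dependence p-prime (fromC oneGRC) (unit-support _) t V b b≢0 r w
    (vanishes-resp (bridge allSel) vanishing)
    λ vanishes → irredundant (allBut w) (allBut-proper w) (vanishes-resp (sym ∘ bridge (allBut w)) vanishes)
  where
  open Vanishing {p} {n} ℂ-zero
  bridge : ∀ S → fromC (prodC r (factors (λ i → t i , V i) S)) ≗
                 ⟦ prod (λ i → Δ (t i ∷ V i) 1) (exponent r S) ⟧ (fromC oneGRC)
  bridge S = factors≗prod fromC mul1-λgv (λ (t , v) → Δ (t ∷ v) 1) (λ { (t , v) F (j ∷ y) → refl })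
                          r (λ i → t i , V i) S oneGRC

lemma2p7 : (p n m r : ℕ) → Prime p → 1 ≤ r → r < p →
    (V : Fin m → Pt p n) →
    (IrredundantFp r V ⊎ IrredundantC r V) →
    (b : Fin m → Fin p) → (∀ i → toℕ (b i) ≢ 0) →
    (w : Fin m) →
    Σ (Fin m → ℤ) λ ε →
      ((+ 1 ℤ.≤ ε w) × (ε w ℤ.≤ + r)) ×
      (∀ i → i ≢ w → (- (+ r) ℤ.≤ ε i) × (ε i ℤ.≤ + r)) ×
      (∀ (k : Fin n) → (+ p) ℤD.∣
        (ε w * ι (b w) * ι (lookup (V w) k)
          - sumExcept w (λ i → ε i * ι (b i) * ι (lookup (V i) k))))
lemma2p7 zero    n m r p-prime _ ()
lemma2p7 (suc q) n m r p-prime _ _ V (inj₁ irredundant) b b≢0 w = Fp-dependence p-prime V irredundant b b≢0 w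
lemma2p7 (suc q) n m r p-prime _ _ V (inj₂ irredundant) b b≢0 w = ℂ-dependence p-prime V irredundant b b≢0 w
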